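{- Let $G=(V,E)$ be a finite directed graph with vertex weights $w:V\to\mathbb{R}^+$ such that $w(u)<w(v)$ for every $(u,v)\in E$, with edge costs $d((u,v))=w(v)-w(u)$, and let $\gamma\geq 0$ be a real threshold. Let $\leq_E$ be the reflexive and transitive closure of $E$ (a partial order on $V$, since $G$ is acyclic), used as the partial order on both factors of $V\times V$. Then the set of tight pairs of $G$ for threshold $\gamma$ coincides with $t(R_{G,\gamma})$.
   Context: A path in $G$ is a sequence $(u_1,\ldots,u_k)$, $k\geq 1$, with $(u_i,u_{i+1})\in E$; its cost is the sum of the costs of its edges (0 if $k=1$). A path $p=(u_1,\ldots,u_k)$ is tight (for $\gamma$) if its cost is $\leq\gamma$ and every path obtained by adding one new edge $(u_0,u_1)\in E$ at the start or $(u_k,u_{k+1})\in E$ at the end has cost $>\gamma$. A tight pair is a pair $(u,v)$ such that some tight path starts at $u$ and ends at $v$. $R_{G,\gamma}\subseteq V\times V$ is the set of pairs $(u,v)$ such that there is a path in $G$ from $u$ to $v$ and $w(v)-w(u)\leq\gamma$. For partially ordered sets $(A,\leq_A),(B,\leq_B)$ and $R\subseteq A\times B$, the tightening is $t(R)=\{(a,b)\in R\mid \forall a'\in A\,\forall b'\in B\,((a'\leq_A a\wedge b\leq_B b'\wedge (a',b')\in R)\Rightarrow(a'=a\wedge b'=b))\}$. -}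

module Defs where

open import Level using (0ℓ)
open import Data.Nat using (ℕ)
open import Data.Fin using (Fin)
open import Data.Product using (_×_; ∃; ∃₂; _,_)
open import Data.Sum using (_⊎_)
open import Relation.Binary.PropositionalEquality using (_≡_; _≢_)
open import Relation.Binary.Construct.Closure.ReflexiveTransitive using (Star)

-- The weights/costs/threshold live in a totally ordered abelian group
-- (ℝ with +, -, 0, ≤ is the intended instance).  Only these operations
-- and laws of ℝ are used by the statement.
record OrderedAbelianGroup : Set₁ where
  infixl 6 _+_
  infix 4 _≤_
  field
    Carrier   : Set
    _+_       : Carrier → Carrier → Carrier
    -_        : Carrier → Carrier
    0#        : Carrier
    +-assoc   : ∀ x y z → (x + y) + z ≡ x + (y + z)
    +-comm    : ∀ x y → x + y ≡ y + x
    +-identityˡ : ∀ x → 0# + x ≡ x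
    -‿inverseˡ : ∀ x → (- x) + x ≡ 0#
    _≤_       : Carrier → Carrier → Set
    ≤-refl    : ∀ {x} → x ≤ x
    ≤-trans   : ∀ {x y z} → x ≤ y → y ≤ z → x ≤ z
    ≤-antisym : ∀ {x y} → x ≤ y → y ≤ x → x ≡ y
    ≤-total   : ∀ x y → x ≤ y ⊎ y ≤ x
    +-monoˡ-≤ : ∀ {x y} z → x ≤ y → x + z ≤ y + z

  infixl 6 _-_
  _-_ : Carrier → Carrier → Carrier
  x - y = x + (- y)

  infix 4 _<_
  _<_ : Carrier → Carrier → Set
  x < y = x ≤ y × x ≢ y

module Graph (𝔾 : OrderedAbelianGroup) {n : ℕ}
             (E : Fin n → Fin n → Set)
             (w : Fin n → OrderedAbelianGroup.Carrier 𝔾)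
             (γ : OrderedAbelianGroup.Carrier 𝔾) where
  open OrderedAbelianGroup 𝔾

  V : Set
  V = Fin n

  d : V → V → Carrier
  d u v = w v - w u

  data Path : V → V → Set where
    [_] : ∀ u → Path u u
    _∷_ : ∀ {u v x} → E u v → Path v x → Path u x

  cost : ∀ {u v} → Path u v → Carrier
  cost [ u ] = 0#
  cost (_∷_ {u} {v} e p) = d u v + cost p

  snoc : ∀ {u v x} → Path u v → E v x → Path u x
  snoc {v = v} {x} [ .v ] e = e ∷ [ x ]
  snoc (e′ ∷ p) e = e′ ∷ snoc p e

  Tight : ∀ {u v} → Path u v → Set
  Tight {u} {v} p =
    cost p ≤ γ
    × (∀ u₀ (e : E u₀ u) → γ < cost (e ∷ p))
    × (∀ v₁ (e : E v v₁) → γ < cost (snoc p e))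

  TightPair : V → V → Set
  TightPair u v = ∃ λ (p : Path u v) → Tight p

  R : V → V → Set
  R u v = Path u v × (w v - w u ≤ γ)

  _≤E_ : V → V → Set
  _≤E_ = Star E

t : {A B : Set} → (A → A → Set) → (B → B → Set) → (A → B → Set) → A → B → Set
t {A} {B} _≤A_ _≤B_ R a b =
  R a b × (∀ (a′ : A) (b′ : B) → a′ ≤A a → b ≤B b′ → R a′ b′ → a′ ≡ a × b′ ≡ b)

{-# OPTIONS --safe #-}
-- The cost of a path telescopes to the weight difference d u v = w v - w u of
-- its endpoints, so a path is in R exactly when its cost is at most γ, and
-- d a b only grows when a moves down or b moves up along ≤E.  Hence a tight
-- path cannot be widened within R: any proper widening costs at least as much
-- as some one-edge extension, which already exceeds γ.  Conversely a one-edge extension of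
-- cost ≤ γ would be a pair of R strictly above (u , v), since E is irreflexive.
module Submission where

open import Defs
open import Data.Nat using (ℕ)
open import Data.Fin using (Fin)
open import Data.Empty using (⊥-elim)
open import Data.Product using (∃; _×_; _,_; proj₁; proj₂)
open import Data.Sum using (_⊎_; inj₁; inj₂)
open import Function.Bundles using (_⇔_; mk⇔)
open import Relation.Nullary using (¬_)
open import Relation.Binary.PropositionalEquality
  using (_≡_; refl; sym; trans; cong; subst; subst₂; module ≡-Reasoning)
open import Relation.Binary.Construct.Closure.ReflexiveTransitive using (Star; ε; _◅_)

module OrderedAbelianGroupProperties (𝔾 : OrderedAbelianGroup) where
  open OrderedAbelianGroup 𝔾

  -‿inverseʳ : ∀ x → x + - x ≡ 0#
  -‿inverseʳ x = trans (+-comm x (- x)) (-‿inverseˡ x)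

  x+y≡0⇒x+[y+z]≡z : ∀ {x y} z → x + y ≡ 0# → x + (y + z) ≡ z
  x+y≡0⇒x+[y+z]≡z {x} {y} z x+y≡0 = begin
    x + (y + z)  ≡⟨ sym (+-assoc x y z) ⟩
    (x + y) + z  ≡⟨ cong (_+ z) x+y≡0 ⟩
    0# + z       ≡⟨ +-identityˡ z ⟩
    z            ∎
    where open ≡-Reasoning

  -‿telescope : ∀ a b c → (b - a) + (c - b) ≡ c - a
  -‿telescope a b c = begin
    (b - a) + (c - b)    ≡⟨ +-comm (b - a) (c - b) ⟩
    (c - b) + (b - a)    ≡⟨ +-assoc c (- b) (b - a) ⟩
    c + (- b + (b - a))  ≡⟨ cong (c +_) (x+y≡0⇒x+[y+z]≡z (- a) (-‿inverseˡ b)) ⟩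
    c - a                ∎
    where open ≡-Reasoning

  neg-antimono-≤ : ∀ {x y} → x ≤ y → - y ≤ - x
  neg-antimono-≤ {x} {y} x≤y = subst₂ _≤_ x+[-x-y]≡-y y+[-x-y]≡-x (+-monoˡ-≤ (- x - y) x≤y)
    where
    x+[-x-y]≡-y : x + (- x - y) ≡ - y
    x+[-x-y]≡-y = x+y≡0⇒x+[y+z]≡z (- y) (-‿inverseʳ x)
    y+[-x-y]≡-x : y + (- x - y) ≡ - x
    y+[-x-y]≡-x = trans (cong (y +_) (+-comm (- x) (- y))) (x+y≡0⇒x+[y+z]≡z (- x) (-‿inverseʳ y))

  minus-mono-≤ : ∀ {x₁ x₂ y₁ y₂} → x₁ ≤ x₂ → y₂ ≤ y₁ → x₁ - y₁ ≤ x₂ - y₂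
  minus-mono-≤ {x₁} {x₂} {y₁} {y₂} x₁≤x₂ y₂≤y₁ = ≤-trans (+-monoˡ-≤ (- y₁) x₁≤x₂)
    (subst₂ _≤_ (+-comm (- y₁) x₂) (+-comm (- y₂) x₂) (+-monoˡ-≤ x₂ (neg-antimono-≤ y₂≤y₁)))

  <⇒≱ : ∀ {x y} → x < y → ¬ y ≤ x
  <⇒≱ (x≤y , x≢y) y≤x = x≢y (≤-antisym x≤y y≤x)

  ≰⇒> : ∀ {x y} → ¬ x ≤ y → y < x
  ≰⇒> {x} {y} x≰y with ≤-total x y
  ... | inj₁ x≤y = ⊥-elim (x≰y x≤y)
  ... | inj₂ y≤x = y≤x , λ { refl → x≰y ≤-refl }

module WeightedDAG (𝔾 : OrderedAbelianGroup) {n : ℕ}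
                   (E : Fin n → Fin n → Set)
                   (w : Fin n → OrderedAbelianGroup.Carrier 𝔾)
                   (γ : OrderedAbelianGroup.Carrier 𝔾)
                   (w-increasing : ∀ u v → E u v → OrderedAbelianGroup._<_ 𝔾 (w u) (w v))
                   where
  open OrderedAbelianGroup 𝔾
  open OrderedAbelianGroupProperties 𝔾
  open Graph 𝔾 E w γ

  E-irreflexive : ∀ {u} → ¬ E u u
  E-irreflexive e = proj₂ (w-increasing _ _ e) refl

  w-mono : ∀ {a b} → a ≤E b → w a ≤ w b
  w-mono ε       = ≤-refl
  w-mono (e ◅ s) = ≤-trans (proj₁ (w-increasing _ _ e)) (w-mono s)

  d-mono : ∀ {a′ a b b′} → a′ ≤E a → b ≤E b′ → d a b ≤ d a′ b′
  d-mono a′≤a b≤b′ = minus-mono-≤ (w-mono b≤b′) (w-mono a′≤a)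

  cost≡d : ∀ {u v} (p : Path u v) → cost p ≡ d u v
  cost≡d [ u ]                   = sym (-‿inverseʳ (w u))
  cost≡d (_∷_ {u} {v} {x} e p) = begin
    d u v + cost p  ≡⟨ cong (d u v +_) (cost≡d p) ⟩
    d u v + d v x   ≡⟨ -‿telescope (w u) (w v) (w x) ⟩
    d u x           ∎
    where open ≡-Reasoning

  ≤E-unsnoc : ∀ {a b} → a ≤E b → a ≡ b ⊎ ∃ λ b₀ → a ≤E b₀ × E b₀ b
  ≤E-unsnoc ε = inj₁ refl
  ≤E-unsnoc (e ◅ s) with ≤E-unsnoc s
  ... | inj₁ refl              = inj₂ (_ , ε , e)
  ... | inj₂ (b₀ , a≤b₀ , e′) = inj₂ (b₀ , e ◅ a≤b₀ , e′)

  Maximal : Fin n → Fin n → Set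
  Maximal u v = ∀ a′ b′ → a′ ≤E u → v ≤E b′ → R a′ b′ → a′ ≡ u × b′ ≡ v

  tight⇒maximal : ∀ {u v} (p : Path u v) → Tight p → Maximal u v
  tight⇒maximal p (_ , left , right) a′ b′ a′≤u v≤b′ (_ , d≤γ) with ≤E-unsnoc a′≤u | v≤b′
  ... | inj₂ (u₀ , a′≤u₀ , e) | _ =
    ⊥-elim (<⇒≱ (subst (γ <_) (cost≡d (e ∷ p)) (left u₀ e)) (≤-trans (d-mono a′≤u₀ v≤b′) d≤γ))
  ... | inj₁ refl | ε = refl , refl
  ... | inj₁ refl | e ◅ v₁≤b′ =
    ⊥-elim (<⇒≱ (subst (γ <_) (cost≡d (snoc p e)) (right _ e)) (≤-trans (d-mono ε v₁≤b′) d≤γ))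

  exceeds : ∀ {a b} (q : Path a b) → ¬ d a b ≤ γ → γ < cost q
  exceeds q d≰γ = subst (γ <_) (sym (cost≡d q)) (≰⇒> d≰γ)

  maximal⇒tight : ∀ {u v} (p : Path u v) → d u v ≤ γ → Maximal u v → Tight p
  maximal⇒tight {u} {v} p d≤γ maximal = subst (_≤ γ) (sym (cost≡d p)) d≤γ , left , right
    where
    left : ∀ u₀ (e : E u₀ u) → γ < cost (e ∷ p)
    left u₀ e = exceeds (e ∷ p) λ d≤γ′ →
      E-irreflexive (subst (λ x → E x u) (proj₁ (maximal u₀ v (e ◅ ε) ε (e ∷ p , d≤γ′))) e)
    right : ∀ v₁ (e : E v v₁) → γ < cost (snoc p e)
    right v₁ e = exceeds (snoc p e) λ d≤γ′ →
      E-irreflexive (subst (E v) (proj₂ (maximal u v₁ ε (e ◅ ε) (snoc p e , d≤γ′))) e)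

  TightPair⇔t : ∀ u v → TightPair u v ⇔ t _≤E_ _≤E_ R u v
  TightPair⇔t u v = mk⇔
    (λ (p , p-tight@(cost≤γ , _)) → (p , subst (_≤ γ) (cost≡d p) cost≤γ) , tight⇒maximal p p-tight)
    (λ ((p , d≤γ) , maximal) → p , maximal⇒tight p d≤γ maximal)

theorem1 : (𝔾 : OrderedAbelianGroup) (n : ℕ) (E : Fin n → Fin n → Set)
    (w : Fin n → OrderedAbelianGroup.Carrier 𝔾)
    (γ : OrderedAbelianGroup.Carrier 𝔾)
    → (∀ u → OrderedAbelianGroup._<_ 𝔾 (OrderedAbelianGroup.0# 𝔾) (w u))
    → (∀ u v → E u v → OrderedAbelianGroup._<_ 𝔾 (w u) (w v))
    → OrderedAbelianGroup._≤_ 𝔾 (OrderedAbelianGroup.0# 𝔾) γ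
    → ∀ u v → Graph.TightPair 𝔾 E w γ u v
      ⇔ t (Graph._≤E_ 𝔾 E w γ) (Graph._≤E_ 𝔾 E w γ) (Graph.R 𝔾 E w γ) u v
theorem1 𝔾 n E w γ _ w-increasing _ = WeightedDAG.TightPair⇔t 𝔾 E w γ w-increasing
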